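{- Let $d\geq 3$ and $k\geq 1$ be integers, let $p_{d,k,n}$ be the number of directed plateau polyhypercubes of dimension $d$, width $k$ and lateral area $n$, and let $P_{d,k}(t)=\sum_{n\geq 1}p_{d,k,n}t^n$. Then, as formal power series, $$P_{d,k}(t)=\frac{t^{k(d-1)}}{(1-t)^{2k(d-1)-(d-1)}}.$$
   Context: Work in $\mathbb{Z}^d$ with orthonormal coordinate system $(0,\vec{i_1},\dots,\vec{i_d})$. A cell is a unit hypercube with integer vertices. A polyhypercube of dimension $d$ is a finite union of cells, connected through their $(d-1)$-dimensional faces, defined up to translation. An elementary step is a positive move of one unit along one of the axes $\vec{i_j}$. A polyhypercube is directed if there is a root cell from which every cell can be reached by a path of cells made only of elementary steps. The width is the number of strata, a stratum being the set of cells with a given $\vec{i_1}$-coordinate. A plateau is a stratum that is a hyperrectangle (box) of cells; a directed plateau polyhypercube is a directed polyhypercube all of whose strata are plateaus. The lateral area of a polyhypercube is the sum, over $2\leq l\leq d$, of the areas (numbers of unit squares) of the polyominoes obtained by projecting it onto the planes $(\vec{i_1},\vec{i_l})$. -}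

module Defs where

open import Data.Nat as ℕ using (ℕ; zero; suc; NonZero; _∸_)
open import Data.Integer as ℤ using (ℤ; +_; _≤_)
open import Data.Fin using (Fin; zero; suc)
open import Data.Vec using (Vec; lookup; updateAt; zipWith)
open import Data.List using (List; map; upTo; tabulate)
open import Data.Nat.ListAction using (sum)
open import Relation.Nullary using (yes; no)
import Data.List.Membership.Propositional as LMem
open import Data.Bool using (Bool; true)
open import Data.Product using (Σ; _×_; _,_; ∃)
open import Data.Sum using (_⊎_)
open import Relation.Binary.PropositionalEquality using (_≡_; _≢_)
open import Function.Bundles using (_⇔_)

-- Finite cardinality of a predicate S on a type A, counted modulo a
-- relation _~_ (which is an equivalence relation in all uses):
-- "S has exactly N elements up to ~".
Card : {A : Set} → (A → Set) → (A → A → Set) → ℕ → Set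
Card {A} S _~_ N =
  Σ (Fin N → A) λ f →
    (∀ i → S (f i)) ×
    (∀ i j → f i ~ f j → i ≡ j) ×
    (∀ x → S x → Σ (Fin N) λ i → x ~ f i)

-- Geometry in ℤ^d.  A cell is identified with its minimal vertex.
Cell : ℕ → Set
Cell d = Vec ℤ d

-- the axis i_1 (index 0)
axis1 : (d : ℕ) → .{{NonZero d}} → Fin d
axis1 (suc _) = zero

step : ∀ {d} → Fin d → Cell d → Cell d
step j c = updateAt c j (λ x → x ℤ.+ + 1)

-- a finite union of cells, given by its (decidable) membership
Shape : ℕ → Set
Shape d = Cell d → Bool

_∈ₛ_ : ∀ {d} → Cell d → Shape d → Set
c ∈ₛ P = P c ≡ true

Translate : ∀ {d} → Shape d → Shape d → Set
Translate {d} P Q = Σ (Cell d) λ v → ∀ c → P c ≡ Q (zipWith ℤ._+_ c v)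

Finite : ∀ {d} → Shape d → Set
Finite {d} P = Σ (List (Cell d)) λ L → ∀ c → c ∈ₛ P →
  LMem._∈_ c L

Adjacent : ∀ {d} → Cell d → Cell d → Set
Adjacent {d} a b = Σ (Fin d) λ j → (b ≡ step j a) ⊎ (a ≡ step j b)

data Path {d} (P : Shape d) (a : Cell d) : Cell d → Set where
  here : a ∈ₛ P → Path P a a
  next : ∀ {b c} → Path P a b → Adjacent b c → c ∈ₛ P → Path P a c

Connected : ∀ {d} → Shape d → Set
Connected P = ∀ a b → a ∈ₛ P → b ∈ₛ P → Path P a b

data DPath {d} (P : Shape d) (a : Cell d) : Cell d → Set where
  here : a ∈ₛ P → DPath P a a
  next : ∀ {b} (j : Fin d) → DPath P a b → step j b ∈ₛ P → DPath P a (step j b)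

Polyhypercube : ∀ {d} → Shape d → Set
Polyhypercube {d} P = Finite P × (Σ (Cell d) λ c → c ∈ₛ P) × Connected P

Directed : ∀ {d} → Shape d → Set
Directed {d} P = Σ (Cell d) λ r → r ∈ₛ P × (∀ c → c ∈ₛ P → DPath P r c)

module _ {d : ℕ} .{{_ : NonZero d}} where

  IsStratum : Shape d → ℤ → Set
  IsStratum P z = Σ (Cell d) λ c → c ∈ₛ P × lookup c (axis1 d) ≡ z

  Width : Shape d → ℕ → Set
  Width P k = Card (IsStratum P) _≡_ k

  AllPlateaus : Shape d → Set
  AllPlateaus P = ∀ z → IsStratum P z →
    Σ (Cell d) λ lo → Σ (Cell d) λ hi →
      ∀ c → lookup c (axis1 d) ≡ z →
        (c ∈ₛ P ⇔ (∀ j → j ≢ axis1 d → (lookup lo j ≤ lookup c j) × (lookup c j ≤ lookup hi j)))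

  -- the projection of P onto the plane (i_1, i_l), as a set of unit squares
  Projection : Shape d → Fin d → ℤ × ℤ → Set
  Projection P l (x , y) = Σ (Cell d) λ c → c ∈ₛ P × lookup c (axis1 d) ≡ x × lookup c l ≡ y

  LateralArea : Shape d → ℕ → Set
  LateralArea P n = Σ (Fin d → ℕ) λ A →
    (∀ l → l ≢ axis1 d → Card (Projection P l) _≡_ (A l)) ×
    A (axis1 d) ≡ 0 × sum (tabulate A) ≡ n

  DPP : ℕ → ℕ → Shape d → Set
  DPP k n P = Polyhypercube P × Directed P × AllPlateaus P × Width P k × LateralArea P n

Series : Set
Series = ℕ → ℕ

_*ˢ_ : Series → Series → Series
(f *ˢ g) n = sum (map (λ i → f i ℕ.* g (n ∸ i)) (upTo (suc n)))

oneˢ : Series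
oneˢ zero = 1
oneˢ (suc _) = 0

_^ˢ_ : Series → ℕ → Series
f ^ˢ zero = oneˢ
f ^ˢ suc r = f *ˢ (f ^ˢ r)

mono : ℕ → Series
mono m n with m ℕ.≟ n
... | yes _ = 1
... | no _ = 0

invOneMinusT : Series
invOneMinusT _ = 1

seriesFrom1 : (ℕ → ℕ) → Series
seriesFrom1 p zero = 0
seriesFrom1 p (suc n) = p (suc n)

-- A directed plateau polyhypercube is a stack of boxes, one per stratum, at consecutive heights.
-- Directedness says exactly that the first box starts at the root and that on every lateral axis
-- the lower end of each box lies within the interval of the box below.  Up to translation the shape
-- is thus a choice, on each of the d − 1 lateral axes, of a chain of k intervals each starting
-- inside the previous one.  Cutting each but the last width at the start of the next interval turns
-- a chain into 2k − 1 free naturals summing to its area minus k, so the shapes of lateral area n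
-- correspond to the vectors in ℕ^((d−1)(2k−1)) with sum n − k(d − 1), which are counted by the
-- coefficient of tⁿ in t^(k(d−1)) / (1 − t)^((d−1)(2k−1)).

module Submission where

open import Defs
open import Data.Nat using (ℕ; _≤_; _*_; _∸_; NonZero)
open import Data.Product using (Σ; _×_)
open import Relation.Binary.PropositionalEquality using (_≡_)

open import Data.Nat using (zero; suc; _+_; _<_; z≤n; s≤s; _≟_)
open import Data.Nat.Properties
  using ( _≤?_; _<?_; ≤-reflexive; ≤-antisym; ≤-trans; <-irrefl; ≮⇒≥; <⇒≱; ≰⇒>; n≤1+n; 1+n≰n; n≤0⇒n≡0
        ; 0≢1+n; 1+n≢0; suc-injective; m≤m+n; m≤n+m; +-monoʳ-≤; +-assoc; +-comm; +-suc; +-identityʳ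
        ; +-cancelˡ-≡; *-identityˡ; *-comm; m+[n∸m]≡n; m+n∸m≡n )
open import Data.Nat.ListAction using (sum)
open import Data.Fin as Fin using (Fin; toℕ; fromℕ<; splitAt; _↑ˡ_; _↑ʳ_; inject₁)
import Data.Fin.Properties as Fin
open import Data.List as List using (List; upTo; applyUpTo)
open import Data.List.Properties using (map-upTo; tabulate-cong)
open import Data.List.Membership.Propositional using (_∈_)
open import Data.List.Membership.Propositional.Properties using (∈-upTo⁺; ∈-cartesianProductWith⁺)
open import Data.List.Relation.Unary.Any using (here)
open import Data.Vec as Vec using (Vec; []; _∷_; _++_; take; drop)
import Data.Vec.Properties as Vec
open import Data.Product using (_,_; proj₁; proj₂; uncurry)
open import Data.Sum as Sum using (_⊎_; inj₁; inj₂; [_,_]′)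
import Data.Sum.Properties as Sum
open import Data.Empty using (⊥-elim)
open import Relation.Nullary using (¬_; Dec; yes; no; does)
open import Relation.Nullary.Decidable using (_×-dec_; dec-true)
open import Function using (_∘_; Injective)
open import Relation.Binary.PropositionalEquality using (refl; sym; trans; cong; cong₂; subst; subst₂; _≢_; module ≡-Reasoning)
open import Data.Nat.Tactic.RingSolver renaming (solve-∀ to ℕ-solve-∀)
open import Data.Integer as ℤ using (ℤ; +_)
import Data.Integer.Properties as ℤ
open import Data.Integer.Tactic.RingSolver renaming (solve-∀ to ℤ-solve-∀)
open import Algebra.Properties.AbelianGroup ℤ.+-0-abelianGroup using (∙-cancelˡ; ∙-cancelʳ)
open import Data.Bool using (Bool; true; false)
open import Function.Bundles using (_⇔_; mk⇔; Equivalence)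
open Equivalence using (to; from)

module _ {A : Set} {S : A → Set} where

  Card-unique : ∀ {m n} → Card S _≡_ m → Card S _≡_ n → m ≡ n
  Card-unique (f , fS , f-inj , f-onto) (g , gS , g-inj , g-onto) =
    ≤-antisym (Fin.injective⇒≤ (reindex-injective f fS f-inj g g-onto))
              (Fin.injective⇒≤ (reindex-injective g gS g-inj f f-onto))
    where
    reindex-injective : ∀ {m n} (f : Fin m → A) (fS : ∀ i → S (f i)) → (∀ i j → f i ≡ f j → i ≡ j) →
      (g : Fin n → A) (g-onto : ∀ x → S x → Σ (Fin n) λ j → x ≡ g j) →
      Injective _≡_ _≡_ (λ i → proj₁ (g-onto (f i) (fS i)))
    reindex-injective f fS f-inj g g-onto {i} {j} e = f-inj i j
      (trans (proj₂ (g-onto (f i) (fS i))) (trans (cong g e) (sym (proj₂ (g-onto (f j) (fS j))))))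

  Card-cong : ∀ {T : A → Set} {_~_ : A → A → Set} {n} →
    (∀ {x} → S x → T x) → (∀ {x} → T x → S x) → Card S _~_ n → Card T _~_ n
  Card-cong S⇒T T⇒S (f , fS , f-inj , f-onto) = f , S⇒T ∘ fS , f-inj , λ x → f-onto x ∘ T⇒S

  Card-empty : ∀ {_~_ : A → A → Set} → (∀ {x} → ¬ S x) → Card S _~_ 0
  Card-empty ¬S = (λ ()) , (λ ()) , (λ ()) , λ x s → ⊥-elim (¬S s)

  Card-map : ∀ {B : Set} {T : B → Set} {_~_ : B → B → Set} {n} (g : A → B) →
    (∀ a a' → S a → S a' → g a ~ g a' → a ≡ a') → (∀ a → S a → T (g a)) →
    (∀ b → T b → Σ A λ a → S a × b ~ g a) → Card S _≡_ n → Card T _~_ n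
  Card-map {_~_ = _~_} g g-inj S⇒T T⇒S (f , fS , f-inj , f-onto) =
    g ∘ f , (λ i → S⇒T (f i) (fS i)) , (λ i j e → f-inj i j (g-inj (f i) (f j) (fS i) (fS j) e)) ,
    λ b tb → let (a , sa , b~ga) = T⇒S b tb ; (i , a≡fi) = f-onto a sa in i , subst (λ a → b ~ g a) a≡fi b~ga

  Card-comap : ∀ {B : Set} {T : B → Set} {n} (g : A → B) →
    (∀ a a' → S a → S a' → g a ≡ g a' → a ≡ a') → (∀ a → S a → T (g a)) →
    (∀ b → T b → Σ A λ a → S a × b ≡ g a) → Card T _≡_ n → Card S _≡_ n
  Card-comap {n = n} g g-inj S⇒T T⇒S (f , fT , f-inj , f-onto) =
    preimage , (λ i → proj₁ (lift i)) ,
    (λ i j e → f-inj i j (trans (proj₂ (lift i)) (trans (cong g e) (sym (proj₂ (lift j)))))) ,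
    λ a sa → let (i , ga≡fi) = f-onto (g a) (S⇒T a sa) in
      i , g-inj a (preimage i) sa (proj₁ (lift i)) (trans ga≡fi (proj₂ (lift i)))
    where
    preimage : Fin n → A
    preimage i = proj₁ (T⇒S (f i) (fT i))
    lift : ∀ i → S (preimage i) × f i ≡ g (preimage i)
    lift i = proj₂ (T⇒S (f i) (fT i))

Card-⊎ : ∀ {A B : Set} {S : A → Set} {T : B → Set} {m n} →
  Card S _≡_ m → Card T _≡_ n → Card [ S , T ]′ _≡_ (m + n)
Card-⊎ {A} {B} {S} {T} {m} {n} (f , fS , f-inj , f-onto) (g , gT , g-inj , g-onto) =
  h ∘ splitAt m , hST ∘ splitAt m , (λ k l e → splitAt-injective (h-inj _ _ e)) , onto
  where
  h : Fin m ⊎ Fin n → A ⊎ B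
  h = Sum.map f g
  hST : ∀ s → [ S , T ]′ (h s)
  hST (inj₁ i) = fS i
  hST (inj₂ j) = gT j
  h-inj : ∀ s s' → h s ≡ h s' → s ≡ s'
  h-inj (inj₁ i) (inj₁ i') e = cong inj₁ (f-inj i i' (Sum.inj₁-injective e))
  h-inj (inj₂ j) (inj₂ j') e = cong inj₂ (g-inj j j' (Sum.inj₂-injective e))
  splitAt-injective : ∀ {k l} → splitAt m k ≡ splitAt m l → k ≡ l
  splitAt-injective {k} {l} e =
    trans (sym (Fin.join-splitAt m n k)) (trans (cong (Fin.join m n) e) (Fin.join-splitAt m n l))
  onto : ∀ x → [ S , T ]′ x → Σ (Fin (m + n)) λ k → x ≡ h (splitAt m k)
  onto (inj₁ a) s = let (i , a≡fi) = f-onto a s in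
    i ↑ˡ n , trans (cong inj₁ a≡fi) (cong h (sym (Fin.splitAt-↑ˡ m i n)))
  onto (inj₂ b) t = let (j , b≡gj) = g-onto b t in
    m ↑ʳ j , trans (cong inj₂ b≡gj) (cong h (sym (Fin.splitAt-↑ʳ m n j)))

Card-Σ : ∀ {X : Set} m (T : Fin m → X → Set) (c : Fin m → ℕ) → (∀ i → Card (T i) _≡_ (c i)) →
  Card (uncurry T) _≡_ (sum (List.tabulate c))
Card-Σ zero T c _ = Card-empty {_~_ = _≡_} λ { {() , _} }
Card-Σ {X} (suc m) T c card =
  Card-map {_~_ = _≡_} g g-inj T⇒ ⇒T (Card-⊎ (card Fin.zero) (Card-Σ m (T ∘ Fin.suc) (c ∘ Fin.suc) (card ∘ Fin.suc)))
  where
  g : X ⊎ (Fin m × X) → Fin (suc m) × X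
  g (inj₁ x) = Fin.zero , x
  g (inj₂ (i , x)) = Fin.suc i , x
  T′ : X ⊎ (Fin m × X) → Set
  T′ = [ T Fin.zero , uncurry (T ∘ Fin.suc) ]′
  g-inj : ∀ a a' → T′ a → T′ a' → g a ≡ g a' → a ≡ a'
  g-inj (inj₁ x) (inj₁ x') _ _ refl = refl
  g-inj (inj₂ (i , x)) (inj₂ (i' , x')) _ _ refl = refl
  T⇒ : ∀ a → T′ a → uncurry T (g a)
  T⇒ (inj₁ x) t = t
  T⇒ (inj₂ (i , x)) t = t
  ⇒T : ∀ p → uncurry T p → Σ _ λ a → T′ a × p ≡ g a
  ⇒T (Fin.zero , x) t = inj₁ x , t , refl
  ⇒T (Fin.suc i , x) t = inj₂ (i , x) , t , refl

downward-closed-card : ∀ {S : ℕ → Set} {K} → (∀ {s t} → s ≤ t → S t → S s) → Card S _≡_ K →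
  ∀ t → (S t → t < K) × (t < K → S t)
downward-closed-card {S} {K} down (f , fS , f-inj , f-onto) t = bounded , complete
  where
  index : ∀ {s} → S s → Fin K
  index s∈ = proj₁ (f-onto _ s∈)
  index-injective : ∀ {s s′} (p : S s) (q : S s′) → index p ≡ index q → s ≡ s′
  index-injective p q e = trans (proj₂ (f-onto _ p)) (trans (cong f e) (sym (proj₂ (f-onto _ q))))
  bounded : S t → t < K
  bounded t∈ with t <? K
  ... | yes t<K = t<K
  ... | no t≮K = ⊥-elim (<-irrefl refl
    (Fin.injective⇒≤ {f = index ∘ below-t} λ e → Fin.toℕ-injective (index-injective _ _ e)))
    where
    below-t : (s : Fin (suc K)) → S (toℕ s)
    below-t s = down (≤-trans (Fin.toℕ≤pred[n] s) (≮⇒≥ t≮K)) t∈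
  complete : t < K → S t
  complete t<K with Fin.any? (λ i → f i ≟ t)
  ... | yes (i , fi≡t) = subst S fi≡t (fS i)
  ... | no ¬hit = ⊥-elim (<⇒≱ t<K (Fin.injective⇒≤ {f = λ i → fromℕ< (below i)} λ {i} {j} e →
          f-inj i j (trans (sym (Fin.toℕ-fromℕ< (below i))) (trans (cong toℕ e) (Fin.toℕ-fromℕ< (below j))))))
    where
    below : ∀ i → f i < t
    below i with f i <? t
    ... | yes fi<t = fi<t
    ... | no fi≮t = let (j , t≡fj) = f-onto t (down (≮⇒≥ fi≮t) (fS i)) in ⊥-elim (¬hit (j , sym t≡fj))

-- Coefficients of t^M / (1 − t)^E

applyUpTo≡tabulate : ∀ {A : Set} (f : ℕ → A) n → applyUpTo f n ≡ List.tabulate {n = n} (f ∘ toℕ)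
applyUpTo≡tabulate f zero = refl
applyUpTo≡tabulate f (suc n) = cong (f 0 List.∷_) (applyUpTo≡tabulate (f ∘ suc) n)

*ˢ-coefficient : ∀ f g n → (f *ˢ g) n ≡ sum (List.tabulate λ (i : Fin (suc n)) → f (toℕ i) * g (n ∸ toℕ i))
*ˢ-coefficient f g n = cong sum (trans (map-upTo h (suc n)) (applyUpTo≡tabulate h (suc n)))
  where
  h : ℕ → ℕ
  h i = f i * g (n ∸ i)

mono-suc : ∀ M i → mono (suc M) (suc i) ≡ mono M i
mono-suc M i with M ≟ i | suc M ≟ suc i
... | yes _ | yes _ = refl
... | no _ | no _ = refl
... | yes M≡i | no M≢i = ⊥-elim (M≢i (cong suc M≡i))
... | no M≢i | yes M≡i = ⊥-elim (M≢i (suc-injective M≡i))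

mono-zero-*ˢ : ∀ G n → (mono 0 *ˢ G) n ≡ G n
mono-zero-*ˢ G n =
  trans (*ˢ-coefficient (mono 0) G n) (trans (cong₂ _+_ (+-identityʳ (G n)) (zeros n)) (+-identityʳ (G n)))
  where
  zeros : ∀ m → sum (List.tabulate {n = m} λ _ → 0) ≡ 0
  zeros zero = refl
  zeros (suc m) = zeros m

mono-suc-*ˢ : ∀ M G n → (mono (suc M) *ˢ G) (suc n) ≡ (mono M *ˢ G) n
mono-suc-*ˢ M G n = trans (*ˢ-coefficient (mono (suc M)) G (suc n))
  (trans (cong sum (tabulate-cong {n = suc n} λ i → cong (_* G (n ∸ toℕ i)) (mono-suc M (toℕ i))))
         (sym (*ˢ-coefficient (mono M) G n)))

Card-Vec-sum : ∀ E s → Card (λ (v : Vec ℕ E) → Vec.sum v ≡ s) _≡_ ((invOneMinusT ^ˢ E) s)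
Card-Vec-sum zero zero = (λ _ → []) , (λ _ → refl) , (λ { Fin.zero Fin.zero _ → refl }) , λ { [] _ → Fin.zero , refl }
Card-Vec-sum zero (suc s) = Card-empty {_~_ = _≡_} λ { {[]} () }
Card-Vec-sum (suc E) s = subst (Card _ _≡_) (sym coefficient)
  (Card-map {_~_ = _≡_} cons cons-inj sums-to-s split
    (Card-Σ (suc s) T (λ i → G (s ∸ toℕ i)) λ i → Card-Vec-sum E (s ∸ toℕ i)))
  where
  G : Series
  G = invOneMinusT ^ˢ E
  T : Fin (suc s) → Vec ℕ E → Set
  T i v = Vec.sum v ≡ s ∸ toℕ i
  coefficient : (invOneMinusT ^ˢ suc E) s ≡ sum (List.tabulate {n = suc s} λ i → G (s ∸ toℕ i))
  coefficient = trans (*ˢ-coefficient invOneMinusT G s) (cong sum (tabulate-cong {n = suc s} λ i → *-identityˡ (G (s ∸ toℕ i))))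
  cons : Fin (suc s) × Vec ℕ E → Vec ℕ (suc E)
  cons (i , v) = toℕ i ∷ v
  cons-inj : ∀ a a' → uncurry T a → uncurry T a' → cons a ≡ cons a' → a ≡ a'
  cons-inj (i , v) (i' , v') _ _ e = cong₂ _,_ (Fin.toℕ-injective (Vec.∷-injectiveˡ e)) (Vec.∷-injectiveʳ e)
  sums-to-s : ∀ a → uncurry T a → Vec.sum (cons a) ≡ s
  sums-to-s (i , v) t = trans (cong (λ u → toℕ i + u) t) (m+[n∸m]≡n (Fin.toℕ≤pred[n] i))
  split : ∀ u → Vec.sum u ≡ s → Σ _ λ a → uncurry T a × u ≡ cons a
  split (x ∷ v) e = (fromℕ< x<1+s , v) , rest , cong (_∷ v) (sym (Fin.toℕ-fromℕ< x<1+s))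
    where
    x<1+s : x < suc s
    x<1+s = s≤s (subst (x ≤_) e (m≤m+n x (Vec.sum v)))
    rest : Vec.sum v ≡ s ∸ toℕ (fromℕ< x<1+s)
    rest = trans (sym (m+n∸m≡n x (Vec.sum v))) (cong₂ _∸_ e (sym (Fin.toℕ-fromℕ< x<1+s)))

Card-Vec-shifted-sum : ∀ M E n →
  Card (λ (v : Vec ℕ E) → M + Vec.sum v ≡ n) _≡_ ((mono M *ˢ (invOneMinusT ^ˢ E)) n)
Card-Vec-shifted-sum zero E n = subst (Card _ _≡_) (sym (mono-zero-*ˢ (invOneMinusT ^ˢ E) n)) (Card-Vec-sum E n)
Card-Vec-shifted-sum (suc M) E zero = Card-empty {_~_ = _≡_} λ ()
Card-Vec-shifted-sum (suc M) E (suc n) = subst (Card _ _≡_) (sym (mono-suc-*ˢ M (invOneMinusT ^ˢ E) n))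
  (Card-cong {_~_ = _≡_} (cong suc) suc-injective (Card-Vec-shifted-sum M E n))

-- Chains of intervals

chainLength : ℕ → ℕ
chainLength zero = 1
chainLength (suc k) = suc (suc (chainLength k))

-- The parameters of a chain of intervals [lower i, lower i + width i], each starting inside the
-- previous one: for every interval but the last, the two parts into which the start of the next one
-- cuts its width, then the last width.
chainLower : ∀ k → Vec ℕ (chainLength k) → ℕ → Fin (suc k) → ℕ
chainLower k v b Fin.zero = b
chainLower (suc k) (o ∷ _ ∷ v) b (Fin.suc i) = chainLower k v (b + o) i

chainWidth : ∀ k → Vec ℕ (chainLength k) → Fin (suc k) → ℕ
chainWidth zero (a ∷ []) Fin.zero = a
chainWidth (suc k) (o ∷ o′ ∷ v) Fin.zero = o + o′
chainWidth (suc k) (o ∷ o′ ∷ v) (Fin.suc i) = chainWidth k v i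

Linked : ∀ {k} → (Fin (suc k) → ℕ) → (Fin (suc k) → ℕ) → Set
Linked {k} lower width =
  ∀ (i : Fin k) → lower (inject₁ i) ≤ lower (Fin.suc i) × lower (Fin.suc i) ≤ lower (inject₁ i) + width (inject₁ i)

chain-linked : ∀ k v b → Linked (chainLower k v b) (chainWidth k v)
chain-linked (suc k) (o ∷ o′ ∷ v) b Fin.zero = m≤m+n b o , +-monoʳ-≤ b (m≤m+n o o′)
chain-linked (suc k) (o ∷ o′ ∷ v) b (Fin.suc i) = chain-linked k v (b + o) i

chain-area : ∀ k v → sum (List.tabulate λ i → suc (chainWidth k v i)) ≡ suc k + Vec.sum v
chain-area zero (a ∷ []) = refl
chain-area (suc k) (o ∷ o′ ∷ v) = trans (cong (λ s → suc (o + o′) + s) (chain-area k v)) (rearrange o o′ k (Vec.sum v))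
  where
  rearrange : ∀ o o′ k s → suc (o + o′) + (suc k + s) ≡ suc (suc k) + (o + (o′ + s))
  rearrange = ℕ-solve-∀

chain-bound : ∀ k v b i → chainLower k v b i + chainWidth k v i ≤ b + Vec.sum v
chain-bound zero (a ∷ []) b Fin.zero = ≤-reflexive (cong (λ s → b + s) (sym (+-identityʳ a)))
chain-bound (suc k) (o ∷ o′ ∷ v) b Fin.zero = +-monoʳ-≤ b (+-monoʳ-≤ o (m≤m+n o′ (Vec.sum v)))
chain-bound (suc k) (o ∷ o′ ∷ v) b (Fin.suc i) = ≤-trans (chain-bound k v (b + o) i)
  (subst (_≤ b + (o + (o′ + Vec.sum v))) (sym (+-assoc b o (Vec.sum v)))
    (+-monoʳ-≤ b (+-monoʳ-≤ o (m≤n+m (Vec.sum v) o′))))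

chain-injective : ∀ k {v v′} b → (∀ i → chainLower k v b i ≡ chainLower k v′ b i) →
  (∀ i → chainWidth k v i ≡ chainWidth k v′ i) → v ≡ v′
chain-injective zero {_ ∷ []} {_ ∷ []} _ _ same-width = cong (_∷ []) (same-width Fin.zero)
chain-injective (suc k) {o ∷ o′ ∷ v} {p ∷ p′ ∷ v′} b same-lower same-width
  with +-cancelˡ-≡ b o p (same-lower (Fin.suc Fin.zero))
... | refl = cong₂ (λ x y → o ∷ x ∷ y) (+-cancelˡ-≡ o o′ p′ (same-width Fin.zero))
  (chain-injective k (b + o) (same-lower ∘ Fin.suc) (same-width ∘ Fin.suc))

chain-surjective : ∀ k (lower width : Fin (suc k) → ℕ) b → lower Fin.zero ≡ b → Linked lower width →
  Σ (Vec ℕ (chainLength k)) λ v → (∀ i → chainLower k v b i ≡ lower i) × (∀ i → chainWidth k v i ≡ width i)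
chain-surjective zero lower width b refl _ = width Fin.zero ∷ [] , (λ { Fin.zero → refl }) , λ { Fin.zero → refl }
chain-surjective (suc k) lower width b refl linked =
  o ∷ o′ ∷ proj₁ rest ,
  (λ { Fin.zero → refl ; (Fin.suc i) → proj₁ (proj₂ rest) i }) ,
  (λ { Fin.zero → width₀-eq ; (Fin.suc i) → proj₂ (proj₂ rest) i })
  where
  o o′ : ℕ
  o = lower (Fin.suc Fin.zero) ∸ b
  o′ = b + width Fin.zero ∸ lower (Fin.suc Fin.zero)
  open ≡-Reasoning
  b+o≡lower₁ : b + o ≡ lower (Fin.suc Fin.zero)
  b+o≡lower₁ = m+[n∸m]≡n (proj₁ (linked Fin.zero))
  width₀-eq : o + o′ ≡ width Fin.zero
  width₀-eq = +-cancelˡ-≡ b (o + o′) (width Fin.zero) (begin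
    b + (o + o′) ≡⟨ +-assoc b o o′ ⟨
    b + o + o′   ≡⟨ cong (_+ o′) b+o≡lower₁ ⟩
    lower (Fin.suc Fin.zero) + o′ ≡⟨ m+[n∸m]≡n (proj₂ (linked Fin.zero)) ⟩
    b + width Fin.zero ∎)
  rest : Σ (Vec ℕ (chainLength k)) λ v →
    (∀ i → chainLower k v (b + o) i ≡ lower (Fin.suc i)) × (∀ i → chainWidth k v i ≡ width (Fin.suc i))
  rest = chain-surjective k (lower ∘ Fin.suc) (width ∘ Fin.suc) (b + o) (sym b+o≡lower₁) (linked ∘ Fin.suc)

axis : ∀ {A : Set} n {m} → Vec A (n * m) → Fin n → Vec A m
axis (suc n) {m} π Fin.zero = take m π
axis (suc n) {m} π (Fin.suc l) = axis n (drop m π) l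

axis-injective : ∀ {A : Set} n {m} {π π′ : Vec A (n * m)} → (∀ l → axis n π l ≡ axis n π′ l) → π ≡ π′
axis-injective zero {π = []} {[]} _ = refl
axis-injective (suc n) {m} {π} {π′} same = begin
  π                       ≡⟨ Vec.take++drop≡id m π ⟨
  take m π ++ drop m π    ≡⟨ cong₂ _++_ (same Fin.zero) (axis-injective n (same ∘ Fin.suc)) ⟩
  take m π′ ++ drop m π′  ≡⟨ Vec.take++drop≡id m π′ ⟩
  π′                      ∎
  where open ≡-Reasoning

axis-surjective : ∀ {A : Set} n {m} (C : Fin n → Vec A m) → Σ (Vec A (n * m)) λ π → ∀ l → axis n π l ≡ C l
axis-surjective zero C = [] , λ ()
axis-surjective (suc n) {m} C with axis-surjective n (C ∘ Fin.suc)
... | π , axis-π = C Fin.zero ++ π , λ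
  { Fin.zero → proj₁ split
  ; (Fin.suc l) → trans (cong (λ ρ → axis n ρ l) (proj₂ split)) (axis-π l) }
  where
  split : take m (C Fin.zero ++ π) ≡ C Fin.zero × drop m (C Fin.zero ++ π) ≡ π
  split = Vec.++-injective (take m (C Fin.zero ++ π)) (C Fin.zero) (Vec.take++drop≡id m (C Fin.zero ++ π))

sum-take-drop : ∀ m {n} (π : Vec ℕ (m + n)) → Vec.sum (take m π) + Vec.sum (drop m π) ≡ Vec.sum π
sum-take-drop m π = trans (sym (Vec.sum-++ (take m π))) (cong Vec.sum (Vec.take++drop≡id m π))

sum-axis : ∀ n {m} K (π : Vec ℕ (n * m)) → sum (List.tabulate λ l → K + Vec.sum (axis n π l)) ≡ n * K + Vec.sum π
sum-axis zero K [] = refl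
sum-axis (suc n) {m} K π = begin
  K + Vec.sum (take m π) + sum (List.tabulate λ l → K + Vec.sum (axis n (drop m π) l))
    ≡⟨ cong (λ s → K + Vec.sum (take m π) + s) (sum-axis n K (drop m π)) ⟩
  K + Vec.sum (take m π) + (n * K + Vec.sum (drop m π))
    ≡⟨ rearrange K (Vec.sum (take m π)) (n * K) (Vec.sum (drop m π)) ⟩
  K + n * K + (Vec.sum (take m π) + Vec.sum (drop m π))
    ≡⟨ cong (λ s → K + n * K + s) (sum-take-drop m π) ⟩
  K + n * K + Vec.sum π ∎
  where
  open ≡-Reasoning
  rearrange : ∀ a b c e → a + b + (c + e) ≡ a + c + (b + e)
  rearrange = ℕ-solve-∀

sum-axis-≤ : ∀ n {m} (π : Vec ℕ (n * m)) l → Vec.sum (axis n π l) ≤ Vec.sum π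
sum-axis-≤ (suc n) {m} π Fin.zero = subst (Vec.sum (take m π) ≤_) (sum-take-drop m π) (m≤m+n _ _)
sum-axis-≤ (suc n) {m} π (Fin.suc l) =
  ≤-trans (sum-axis-≤ n (drop m π) l) (subst (Vec.sum (drop m π) ≤_) (sum-take-drop m π) (m≤n+m _ _))

≤⇒offset : ∀ {a b} → a ℤ.≤ b → Σ ℕ λ m → b ≡ a ℤ.+ + m
≤⇒offset {a} {b} a≤b = ℤ.∣ b ℤ.- a ∣ , (begin
  b                  ≡⟨ b≡a+[b-a] a b ⟩
  a ℤ.+ (b ℤ.- a)    ≡⟨ cong (λ t → a ℤ.+ t) (ℤ.0≤i⇒+∣i∣≡i (ℤ.i≤j⇒0≤j-i a≤b)) ⟨
  a ℤ.+ + ℤ.∣ b ℤ.- a ∣ ∎)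
  where
  open ≡-Reasoning
  b≡a+[b-a] : ∀ a b → b ≡ a ℤ.+ (b ℤ.- a)
  b≡a+[b-a] = ℤ-solve-∀

offset-injective : ∀ a {m n} → a ℤ.+ + m ≡ a ℤ.+ + n → m ≡ n
offset-injective a e = ℤ.+-injective (∙-cancelˡ a _ _ e)

+-cancelˡ-≤ℤ : ∀ a {i j} → a ℤ.+ i ℤ.≤ a ℤ.+ j → i ℤ.≤ j
+-cancelˡ-≤ℤ a {i} {j} le = subst₂ ℤ._≤_ (cancel a i) (cancel a j) (ℤ.+-monoʳ-≤ (ℤ.- a) le)
  where
  cancel : ∀ a i → ℤ.- a ℤ.+ (a ℤ.+ i) ≡ i
  cancel = ℤ-solve-∀

+-cancelʳ-≤ℤ : ∀ a {i j} → i ℤ.+ a ℤ.≤ j ℤ.+ a → i ℤ.≤ j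
+-cancelʳ-≤ℤ a {i} {j} le = +-cancelˡ-≤ℤ a (subst₂ ℤ._≤_ (ℤ.+-comm i a) (ℤ.+-comm j a) le)

offset-cancel-≤ : ∀ a {m n} → a ℤ.+ + m ℤ.≤ a ℤ.+ + n → m ≤ n
offset-cancel-≤ a le = ℤ.drop‿+≤+ (+-cancelˡ-≤ℤ a le)

offset-mono-≤ : ∀ a {m n} → m ≤ n → a ℤ.+ + m ℤ.≤ a ℤ.+ + n
offset-mono-≤ a m≤n = ℤ.+-monoʳ-≤ a (ℤ.+≤+ m≤n)

offset-suc : ∀ a s → a ℤ.+ + s ℤ.+ + 1 ≡ a ℤ.+ + suc s
offset-suc a s = trans (ℤ.+-assoc a (+ s) (+ 1)) (cong (λ t → a ℤ.+ + t) (+-comm s 1))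

InInterval : ℤ → ℕ → ℤ → Set
InInterval a w y = a ℤ.≤ y × y ℤ.≤ a ℤ.+ + w

InInterval-shift : ∀ a w y t → InInterval a w y ⇔ InInterval (a ℤ.+ t) w (y ℤ.+ t)
InInterval-shift a w y t = mk⇔
  (λ (a≤y , y≤a+w) → ℤ.+-monoˡ-≤ t a≤y , subst (y ℤ.+ t ℤ.≤_) (swap a (+ w) t) (ℤ.+-monoˡ-≤ t y≤a+w))
  (λ (a≤y , y≤a+w) → +-cancelʳ-≤ℤ t a≤y , +-cancelʳ-≤ℤ t (subst (y ℤ.+ t ℤ.≤_) (sym (swap a (+ w) t)) y≤a+w))
  where
  swap : ∀ a b t → a ℤ.+ b ℤ.+ t ≡ a ℤ.+ t ℤ.+ b
  swap = ℤ-solve-∀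

InInterval-lower : ∀ a w → InInterval a w a
InInterval-lower a w = ℤ.≤-refl , ℤ.i≤i+j a (+ w)

InInterval-upper : ∀ a w → InInterval a w (a ℤ.+ + w)
InInterval-upper a w = ℤ.i≤i+j a (+ w) , ℤ.≤-refl

Card-interval : ∀ a w → Card (InInterval a w) _≡_ (suc w)
Card-interval a w = point , inside , (λ i j e → Fin.toℕ-injective (offset-injective a e)) , onto
  where
  point : Fin (suc w) → ℤ
  point j = a ℤ.+ + toℕ j
  inside : ∀ j → InInterval a w (point j)
  inside j = ℤ.i≤i+j a (+ toℕ j) , offset-mono-≤ a (Fin.toℕ≤pred[n] j)
  onto : ∀ y → InInterval a w y → Σ (Fin (suc w)) λ j → y ≡ point j
  onto y (a≤y , y≤a+w) with ≤⇒offset a≤y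
  ... | m , refl = fromℕ< (s≤s (offset-cancel-≤ a y≤a+w)) , cong (λ t → a ℤ.+ + t) (sym (Fin.toℕ-fromℕ< _))

level-injective : ∀ {k} z {i j : Fin k} {x} → x ≡ z ℤ.+ + toℕ i → x ≡ z ℤ.+ + toℕ j → i ≡ j
level-injective z e e′ = Fin.toℕ-injective (offset-injective z (trans (sym e) e′))

-- Stacks of boxes

≡true-⇔⇒≡ : ∀ {a b : Bool} → (a ≡ true → b ≡ true) → (b ≡ true → a ≡ true) → a ≡ b
≡true-⇔⇒≡ {true} a⇒b _ = sym (a⇒b refl)
≡true-⇔⇒≡ {false} {true} _ b⇒a = b⇒a refl
≡true-⇔⇒≡ {false} {false} _ _ = refl

record Stack (d′ k : ℕ) : Set where
  constructor stack
  field
    base  : ℤ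
    lower : Fin d′ → Fin k → ℤ
    width : Fin d′ → Fin k → ℕ
open Stack

module _ {d′ k : ℕ} where

  _∈ˢ_ : Cell (suc d′) → Stack d′ k → Set
  (x ∷ cs) ∈ˢ σ =
    Σ (Fin k) λ i → x ≡ base σ ℤ.+ + toℕ i × ∀ l → InInterval (lower σ l i) (width σ l i) (Vec.lookup cs l)

  Realises : Shape (suc d′) → Stack d′ k → Set
  Realises Q σ = ∀ c → c ∈ₛ Q ⇔ c ∈ˢ σ

  _∈ˢ?_ : ∀ c σ → Dec (c ∈ˢ σ)
  (x ∷ cs) ∈ˢ? σ = Fin.any? λ i → (x ℤ.≟ base σ ℤ.+ + toℕ i) ×-dec Fin.all? λ l →
    (lower σ l i ℤ.≤? Vec.lookup cs l) ×-dec (Vec.lookup cs l ℤ.≤? lower σ l i ℤ.+ + width σ l i)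

  lowerCorner upperCorner : Stack d′ k → Fin k → Cell (suc d′)
  lowerCorner σ i = (base σ ℤ.+ + toℕ i) ∷ Vec.tabulate (λ l → lower σ l i)
  upperCorner σ i = (base σ ℤ.+ + toℕ i) ∷ Vec.tabulate (λ l → lower σ l i ℤ.+ + width σ l i)

  lowerCorner-∈ˢ : ∀ σ i → lowerCorner σ i ∈ˢ σ
  lowerCorner-∈ˢ σ i = i , refl , λ l →
    subst (InInterval _ _) (sym (Vec.lookup∘tabulate (λ l → lower σ l i) l)) (InInterval-lower _ _)

  upperCorner-∈ˢ : ∀ σ i → upperCorner σ i ∈ˢ σ
  upperCorner-∈ˢ σ i = i , refl , λ l →
    subst (InInterval _ _) (sym (Vec.lookup∘tabulate (λ l → lower σ l i ℤ.+ + width σ l i) l)) (InInterval-upper _ _)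

  stack-width : ∀ {Q σ} → Realises Q σ → Width Q k
  stack-width {σ = σ} Q≡σ =
    (λ i → base σ ℤ.+ + toℕ i) , (λ i → lowerCorner σ i , from (Q≡σ _) (lowerCorner-∈ˢ σ i) , refl) ,
    (λ i j → level-injective (base σ) refl) ,
    λ { z ((x ∷ cs) , c∈Q , refl) → let (i , x≡ , _) = to (Q≡σ _) c∈Q in i , x≡ }

  stack-plateaus : ∀ {Q σ} → Realises Q σ → AllPlateaus Q
  stack-plateaus {Q} {σ} Q≡σ z ((x ∷ cs) , c∈Q , refl) with to (Q≡σ _) c∈Q
  ... | i , x≡ , _ = lo , hi , λ c c₀≡x → mk⇔ (in-box c c₀≡x) (box-in c c₀≡x)
    where
    lo hi : Cell (suc d′)
    lo = base σ ∷ Vec.tabulate (λ l → lower σ l i)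
    hi = base σ ∷ Vec.tabulate (λ l → lower σ l i ℤ.+ + width σ l i)
    box-bounds : ∀ cs′ l → InInterval (lower σ l i) (width σ l i) (Vec.lookup cs′ l) ⇔
      (Vec.lookup lo (Fin.suc l) ℤ.≤ Vec.lookup cs′ l × Vec.lookup cs′ l ℤ.≤ Vec.lookup hi (Fin.suc l))
    box-bounds cs′ l rewrite Vec.lookup∘tabulate (λ l → lower σ l i) l
                           | Vec.lookup∘tabulate (λ l → lower σ l i ℤ.+ + width σ l i) l = mk⇔ (λ p → p) (λ p → p)
    in-box : ∀ c → Vec.lookup c Fin.zero ≡ x → c ∈ₛ Q → ∀ j → j ≢ Fin.zero →
      (Vec.lookup lo j ℤ.≤ Vec.lookup c j) × (Vec.lookup c j ℤ.≤ Vec.lookup hi j)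
    in-box (x′ ∷ cs′) refl c∈Q′ Fin.zero j≢0 = ⊥-elim (j≢0 refl)
    in-box (x′ ∷ cs′) refl c∈Q′ (Fin.suc l) _ with to (Q≡σ _) c∈Q′
    ... | i′ , x′≡ , bounds with level-injective (base σ) x′≡ x≡
    ... | refl = to (box-bounds cs′ l) (bounds l)
    box-in : ∀ c → Vec.lookup c Fin.zero ≡ x → (∀ j → j ≢ Fin.zero →
      (Vec.lookup lo j ℤ.≤ Vec.lookup c j) × (Vec.lookup c j ℤ.≤ Vec.lookup hi j)) → c ∈ₛ Q
    box-in (x′ ∷ cs′) refl bounds = from (Q≡σ _) (i , x≡ , λ l → from (box-bounds cs′ l) (bounds (Fin.suc l) λ ()))

  stack-projection : ∀ {Q σ} → Realises Q σ → ∀ l →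
    Card (Projection Q (Fin.suc l)) _≡_ (sum (List.tabulate λ i → suc (width σ l i)))
  stack-projection {Q} {σ} Q≡σ l =
    Card-map {_~_ = _≡_} proj₂
      (λ { (i , p) (i′ , .p) (x≡ , _) (x≡′ , _) refl → cong (_, p) (level-injective (base σ) x≡ x≡′) })
      on-projection from-projection (Card-Σ k T _ Card-T)
    where
    T : Fin k → ℤ × ℤ → Set
    T i (x , y) = x ≡ base σ ℤ.+ + toℕ i × InInterval (lower σ l i) (width σ l i) y
    Card-T : ∀ i → Card (T i) _≡_ (suc (width σ l i))
    Card-T i = Card-map {_~_ = _≡_} (base σ ℤ.+ + toℕ i ,_) (λ _ _ _ _ → cong proj₂) (λ y y∈ → refl , y∈)
      (λ { (x , y) (x≡ , y∈) → y , y∈ , cong (_, y) x≡ }) (Card-interval (lower σ l i) (width σ l i))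
    on-projection : ∀ a → uncurry T a → Projection Q (Fin.suc l) (proj₂ a)
    on-projection (i , (x , y)) (refl , y∈) =
      (x ∷ cs) , from (Q≡σ _) (i , refl , in-box) , refl , Vec.lookup∘update l corner y
      where
      corner cs : Vec ℤ d′
      corner = Vec.tabulate (λ m → lower σ m i)
      cs = corner Vec.[ l ]≔ y
      in-box : ∀ m → InInterval (lower σ m i) (width σ m i) (Vec.lookup cs m)
      in-box m with m Fin.≟ l
      ... | yes refl = subst (InInterval _ _) (sym (Vec.lookup∘update l corner y)) y∈
      ... | no m≢l = subst (InInterval _ _)
        (sym (trans (Vec.lookup∘update′ m≢l corner y) (Vec.lookup∘tabulate (λ m → lower σ m i) m))) (InInterval-lower _ _)
    from-projection : ∀ p → Projection Q (Fin.suc l) p → Σ (Fin k × (ℤ × ℤ)) λ a → uncurry T a × p ≡ proj₂ a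
    from-projection (x , y) ((x′ ∷ cs) , c∈Q , refl , refl) with to (Q≡σ _) c∈Q
    ... | i , x≡ , bounds = (i , (x′ , Vec.lookup cs l)) , (x≡ , bounds l) , refl

  _≈ˢ_ : Stack d′ k → Stack d′ k → Set
  σ ≈ˢ τ = base σ ≡ base τ × (∀ l i → lower σ l i ≡ lower τ l i) × (∀ l i → width σ l i ≡ width τ l i)

  ≈ˢ-sym : ∀ {σ τ} → σ ≈ˢ τ → τ ≈ˢ σ
  ≈ˢ-sym (b≡ , lo≡ , w≡) = sym b≡ , (λ l i → sym (lo≡ l i)) , λ l i → sym (w≡ l i)

  ∈ˢ-resp-≈ˢ : ∀ {σ τ} c → σ ≈ˢ τ → c ∈ˢ σ → c ∈ˢ τ
  ∈ˢ-resp-≈ˢ (x ∷ cs) (b≡ , lo≡ , w≡) (i , x≡ , bounds) =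
    i , trans x≡ (cong (ℤ._+ + toℕ i) b≡) , λ l → subst₂ (λ a w → InInterval a w _) (lo≡ l i) (w≡ l i) (bounds l)

  Realises-resp-≈ˢ : ∀ {Q σ τ} → σ ≈ˢ τ → Realises Q σ → Realises Q τ
  Realises-resp-≈ˢ σ≈τ Q≡σ c =
    mk⇔ (∈ˢ-resp-≈ˢ c σ≈τ ∘ to (Q≡σ c)) (from (Q≡σ c) ∘ ∈ˢ-resp-≈ˢ c (≈ˢ-sym σ≈τ))

  stack-unique : ∀ {Q σ τ} → Realises Q σ → Realises Q τ → base σ ≡ base τ → σ ≈ˢ τ
  stack-unique {Q} {σ} {τ} Q≡σ Q≡τ b≡ = b≡ , lower-≡ , λ l i →
    ℤ.+-injective (∙-cancelˡ (lower σ l i) _ _ (trans (upper-≡ l i) (cong (ℤ._+ _) (sym (lower-≡ l i)))))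
    where
    compare : ∀ {σ τ} → Realises Q σ → Realises Q τ → base σ ≡ base τ → ∀ l i →
      lower τ l i ℤ.≤ lower σ l i × lower σ l i ℤ.+ + width σ l i ℤ.≤ lower τ l i ℤ.+ + width τ l i
    compare {σ} {τ} Q≡σ Q≡τ b≡ l i
      with to (Q≡τ (lowerCorner σ i)) (from (Q≡σ _) (lowerCorner-∈ˢ σ i))
         | to (Q≡τ (upperCorner σ i)) (from (Q≡σ _) (upperCorner-∈ˢ σ i))
    ... | i₁ , x₁≡ , bounds₁ | i₂ , x₂≡ , bounds₂
      with level-injective (base τ) (cong (ℤ._+ + toℕ i) b≡) x₁≡
         | level-injective (base τ) (cong (ℤ._+ + toℕ i) b≡) x₂≡
    ... | refl | refl =
      subst (lower τ l i ℤ.≤_) (Vec.lookup∘tabulate (λ l → lower σ l i) l) (proj₁ (bounds₁ l)) ,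
      subst (ℤ._≤ lower τ l i ℤ.+ + width τ l i) (Vec.lookup∘tabulate (λ l → lower σ l i ℤ.+ + width σ l i) l)
        (proj₂ (bounds₂ l))
    lower-≡ : ∀ l i → lower σ l i ≡ lower τ l i
    lower-≡ l i = ℤ.≤-antisym (proj₁ (compare Q≡τ Q≡σ (sym b≡) l i)) (proj₁ (compare Q≡σ Q≡τ b≡ l i))
    upper-≡ : ∀ l i → lower σ l i ℤ.+ + width σ l i ≡ lower τ l i ℤ.+ + width τ l i
    upper-≡ l i = ℤ.≤-antisym (proj₂ (compare Q≡σ Q≡τ b≡ l i)) (proj₂ (compare Q≡τ Q≡σ (sym b≡) l i))

  shift : Cell (suc d′) → Stack d′ k → Stack d′ k
  shift (v₀ ∷ vs) σ = stack (base σ ℤ.+ v₀) (λ l i → lower σ l i ℤ.+ Vec.lookup vs l) (width σ)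

  ∈ˢ-shift : ∀ σ c v → c ∈ˢ σ ⇔ Vec.zipWith ℤ._+_ c v ∈ˢ shift v σ
  ∈ˢ-shift σ (x ∷ cs) (v₀ ∷ vs) = mk⇔
    (λ (i , x≡ , bounds) → i , shift-level x≡ , λ l → shift-bounds l (bounds l))
    (λ (i , x≡ , bounds) → i , unshift-level x≡ , λ l → unshift-bounds l (bounds l))
    where
    swap : ∀ a b t → a ℤ.+ b ℤ.+ t ≡ a ℤ.+ t ℤ.+ b
    swap = ℤ-solve-∀
    lookup-+ : ∀ l → Vec.lookup (Vec.zipWith ℤ._+_ cs vs) l ≡ Vec.lookup cs l ℤ.+ Vec.lookup vs l
    lookup-+ l = Vec.lookup-zipWith ℤ._+_ l cs vs
    shift-level : ∀ {i} → x ≡ base σ ℤ.+ + i → x ℤ.+ v₀ ≡ base σ ℤ.+ v₀ ℤ.+ + i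
    shift-level {i} x≡ = trans (cong (ℤ._+ v₀) x≡) (swap (base σ) (+ i) v₀)
    unshift-level : ∀ {i} → x ℤ.+ v₀ ≡ base σ ℤ.+ v₀ ℤ.+ + i → x ≡ base σ ℤ.+ + i
    unshift-level {i} x≡ = ∙-cancelʳ v₀ x _ (trans x≡ (sym (swap (base σ) (+ i) v₀)))
    shift-bounds : ∀ l {a w} → InInterval a w (Vec.lookup cs l) →
      InInterval (a ℤ.+ Vec.lookup vs l) w (Vec.lookup (Vec.zipWith ℤ._+_ cs vs) l)
    shift-bounds l {a} {w} = subst (InInterval _ w) (sym (lookup-+ l)) ∘ to (InInterval-shift a w _ (Vec.lookup vs l))
    unshift-bounds : ∀ l {a w} → InInterval (a ℤ.+ Vec.lookup vs l) w (Vec.lookup (Vec.zipWith ℤ._+_ cs vs) l) →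
      InInterval a w (Vec.lookup cs l)
    unshift-bounds l {a} {w} = from (InInterval-shift a w _ (Vec.lookup vs l)) ∘ subst (InInterval _ w) (lookup-+ l)

  stack-translate : ∀ {P Q σ} v → Realises P σ → Realises Q (shift v σ) → Translate P Q
  stack-translate {σ = σ} v P≡σ Q≡σ+v = v , λ c → ≡true-⇔⇒≡
    (from (Q≡σ+v _) ∘ to (∈ˢ-shift σ c v) ∘ to (P≡σ c))
    (from (P≡σ c) ∘ from (∈ˢ-shift σ c v) ∘ to (Q≡σ+v _))

module _ {d : ℕ} {P : Shape d} where

  Path-trans : ∀ {a b c} → Path P a b → Path P b c → Path P a c
  Path-trans p (here _) = p
  Path-trans p (next q b~c c∈P) = next (Path-trans p q) b~c c∈P

  Path-sym : ∀ {a b} → Path P a b → Path P b a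
  Path-sym (here a∈P) = here a∈P
  Path-sym (next q (j , b≡ ) c∈P) = Path-trans (next (here c∈P) (j , Sum.swap b≡) (Path-end q)) (Path-sym q)
    where
    Path-end : ∀ {a b} → Path P a b → b ∈ₛ P
    Path-end (here b∈P) = b∈P
    Path-end (next _ _ b∈P) = b∈P

  DPath⇒Path : ∀ {a b} → DPath P a b → Path P a b
  DPath⇒Path (here a∈P) = here a∈P
  DPath⇒Path (next j q b∈P) = next (DPath⇒Path q) (j , inj₁ refl) b∈P

  directed⇒connected : Directed P → Connected P
  directed⇒connected (_ , _ , reach) a b a∈P b∈P =
    Path-trans (Path-sym (DPath⇒Path (reach a a∈P))) (DPath⇒Path (reach b b∈P))

  Descends : (Cell d → ℕ) → Cell d → Cell d → Set
  Descends μ r c = c ≡ r ⊎ Σ (Fin d) λ j → Σ (Cell d) λ b → b ∈ₛ P × step j b ≡ c × suc (μ b) ≡ μ c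

  directed-by-descent : (μ : Cell d → ℕ) (r : Cell d) → r ∈ₛ P → (∀ c → c ∈ₛ P → Descends μ r c) → Directed P
  directed-by-descent μ r r∈P descend = r , r∈P , λ c c∈P → reach (μ c) c c∈P refl
    where
    reach : ∀ N c → c ∈ₛ P → μ c ≡ N → DPath P r c
    reach N c c∈P μc≡N with descend c c∈P
    ... | inj₁ refl = here r∈P
    reach zero c c∈P μc≡0 | inj₂ (_ , _ , _ , _ , μb<μc) = ⊥-elim (1+n≢0 (trans μb<μc μc≡0))
    reach (suc N) c c∈P μc≡ | inj₂ (j , b , b∈P , refl , μb<μc) =
      next j (reach N b b∈P (suc-injective (trans μb<μc μc≡))) c∈P

step-mono : ∀ {n} (b : Vec ℤ n) j m → Vec.lookup b m ℤ.≤ Vec.lookup (step j b) m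
step-mono b j m with m Fin.≟ j
... | yes refl = subst (Vec.lookup b m ℤ.≤_) (sym (Vec.lookup∘updateAt m b)) (ℤ.i≤i+j _ (+ 1))
... | no m≢j = ℤ.≤-reflexive (sym (Vec.lookup∘updateAt′ m j m≢j b))

step-bounded : ∀ {n} (b : Vec ℤ n) j m → Vec.lookup (step j b) m ℤ.≤ Vec.lookup b m ℤ.+ + 1
step-bounded b j m with m Fin.≟ j
... | yes refl = ℤ.≤-reflexive (Vec.lookup∘updateAt m b)
... | no m≢j = subst (ℤ._≤ _) (sym (Vec.lookup∘updateAt′ m j m≢j b)) (ℤ.i≤i+j _ (+ 1))

DPath-mono : ∀ {d} {P : Shape d} {r c} → DPath P r c → ∀ j → Vec.lookup r j ℤ.≤ Vec.lookup c j
DPath-mono (here _) j = ℤ.≤-refl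
DPath-mono (next {b} j′ q _) j = ℤ.≤-trans (DPath-mono q j) (step-mono b j′ j)

DPath-last : ∀ {d} {P : Shape d} {r c} → DPath P r c →
  r ≡ c ⊎ Σ (Fin d) λ j → Σ (Cell d) λ b → b ∈ₛ P × step j b ≡ c
DPath-last (here _) = inj₁ refl
DPath-last {P = P} (next {b} j q _) = inj₂ (j , b , DPath-end q , refl)
  where
  DPath-end : ∀ {a b} → DPath P a b → b ∈ₛ P
  DPath-end (here b∈P) = b∈P
  DPath-end (next _ _ b∈P) = b∈P

-- Canonical representatives

norm : ∀ {n} → Vec ℤ n → ℕ
norm c = Vec.sum (Vec.map ℤ.∣_∣ c)

step-down : ∀ {n} (c : Vec ℤ n) j t → Vec.lookup c j ≡ + suc t →
  step j (c Vec.[ j ]≔ + t) ≡ c × suc (norm (c Vec.[ j ]≔ + t)) ≡ norm c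
step-down (x ∷ c) Fin.zero t refl = cong (λ y → + y ∷ c) (+-comm t 1) , refl
step-down (x ∷ c) (Fin.suc j) t cj≡ =
  cong (x ∷_) (proj₁ (step-down c j t cj≡)) ,
  trans (sym (+-suc ℤ.∣ x ∣ _)) (cong (λ s → ℤ.∣ x ∣ + s) (proj₂ (step-down c j t cj≡)))

cube : ∀ n → ℕ → List (Vec ℤ n)
cube zero B = [] List.∷ List.[]
cube (suc n) B = List.cartesianProductWith (λ a c → + a ∷ c) (upTo (suc B)) (cube n B)

∈-cube : ∀ n B (c : Vec ℤ n) → (∀ j → Σ ℕ λ a → Vec.lookup c j ≡ + a × a ≤ B) → c ∈ cube n B
∈-cube zero B [] _ = here refl
∈-cube (suc n) B (x ∷ c) bounded with bounded Fin.zero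
... | a , refl , a≤B =
  ∈-cartesianProductWith⁺ (λ a c → + a ∷ c) (∈-upTo⁺ (s≤s a≤B)) (∈-cube n B c (bounded ∘ Fin.suc))

does-true : ∀ {A : Set} (a? : Dec A) → does a? ≡ true → A
does-true (yes a) _ = a
does-true (no _) ()

positive-above : ∀ {a y} → + a ℤ.< y → Σ ℕ λ t → y ≡ + suc t × a ≤ t
positive-above {y = + suc t} (ℤ.+<+ (s≤s a≤t)) = t , refl , a≤t

zero-vector : ∀ {n} (v : Vec ℤ n) → (∀ j → + 0 ℤ.≤ Vec.lookup v j) →
  (∀ j → + 0 ℤ.≤ Vec.lookup (Vec.map ℤ.-_ v) j) → v ≡ Vec.replicate n (+ 0)
zero-vector [] _ _ = refl
zero-vector (x ∷ v) v≥0 -v≥0 =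
  cong₂ _∷_ (ℤ.≤-antisym x≤0 (v≥0 Fin.zero)) (zero-vector v (v≥0 ∘ Fin.suc) (-v≥0 ∘ Fin.suc))
  where
  x≤0 : x ℤ.≤ + 0
  x≤0 = subst (ℤ._≤ + 0) (ℤ.neg-involutive x) (ℤ.neg-mono-≤ (-v≥0 Fin.zero))

Parameters : ℕ → ℕ → Set
Parameters d′ k = Vec ℕ (d′ * chainLength k)

module Canonical {d′ k : ℕ} (π : Parameters d′ k) where

  lowerℕ widthℕ : Fin d′ → Fin (suc k) → ℕ
  lowerℕ l = chainLower k (axis d′ π l) 0
  widthℕ l = chainWidth k (axis d′ π l)

  canonicalStack : Stack d′ (suc k)
  canonicalStack = stack (+ 0) (λ l i → + lowerℕ l i) widthℕ

  canonical : Shape (suc d′)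
  canonical c = does (c ∈ˢ? canonicalStack)

  canonical-realises : Realises canonical canonicalStack
  canonical-realises c = mk⇔ (does-true (c ∈ˢ? canonicalStack)) (dec-true (c ∈ˢ? canonicalStack))

  origin : Cell (suc d′)
  origin = Vec.replicate (suc d′) (+ 0)

  origin-∈ : origin ∈ₛ canonical
  origin-∈ = from (canonical-realises origin) (Fin.zero , refl , λ l →
    subst (InInterval (+ 0) (widthℕ l Fin.zero)) (sym (Vec.lookup-replicate l (+ 0))) (InInterval-lower _ _))

  descend-lateral : ∀ x cs i → x ≡ + toℕ i → (∀ l → InInterval (+ lowerℕ l i) (widthℕ l i) (Vec.lookup cs l)) →
    ∀ l t → Vec.lookup cs l ≡ + suc t → lowerℕ l i ≤ t → Descends {P = canonical} norm origin (x ∷ cs)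
  descend-lateral x cs i x≡ bounds l t cs-l≡ lower≤t = inj₂ (Fin.suc l , (x ∷ cs′) ,
    from (canonical-realises (x ∷ cs′)) (i , x≡ , bounds′) , cong (x ∷_) step≡ ,
    trans (sym (+-suc ℤ.∣ x ∣ _)) (cong (λ s → ℤ.∣ x ∣ + s) norm≡))
    where
    cs′ : Vec ℤ d′
    cs′ = cs Vec.[ l ]≔ + t
    step≡ : step l cs′ ≡ cs
    step≡ = proj₁ (step-down cs l t cs-l≡)
    norm≡ : suc (norm cs′) ≡ norm cs
    norm≡ = proj₂ (step-down cs l t cs-l≡)
    bounds′ : ∀ m → InInterval (+ lowerℕ m i) (widthℕ m i) (Vec.lookup cs′ m)
    bounds′ m with m Fin.≟ l
    ... | yes refl = subst (InInterval _ _) (sym (Vec.lookup∘update l cs (+ t)))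
      (ℤ.+≤+ lower≤t , ℤ.≤-trans (ℤ.+≤+ (n≤1+n t)) (subst (ℤ._≤ _) cs-l≡ (proj₂ (bounds l))))
    ... | no m≢l = subst (InInterval _ _) (sym (Vec.lookup∘update′ m≢l cs (+ t))) (bounds m)

  descend-corner : ∀ x cs (i : Fin (suc k)) → x ≡ + toℕ i → (∀ l → Vec.lookup cs l ≡ + lowerℕ l i) →
    Descends {P = canonical} norm origin (x ∷ cs)
  descend-corner x cs Fin.zero refl cs≡ = inj₁ (cong (+ 0 ∷_) (begin
    cs                                                  ≡⟨ Vec.tabulate∘lookup cs ⟨
    Vec.tabulate (Vec.lookup cs)
      ≡⟨ Vec.tabulate-cong (λ l → trans (cs≡ l) (sym (Vec.lookup-replicate l (+ 0)))) ⟩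
    Vec.tabulate (Vec.lookup (Vec.replicate d′ (+ 0)))  ≡⟨ Vec.tabulate∘lookup _ ⟩
    Vec.replicate d′ (+ 0)                              ∎))
    where open ≡-Reasoning
  descend-corner x cs (Fin.suc i) refl cs≡ = inj₂ (Fin.zero , (+ toℕ i ∷ cs) ,
    from (canonical-realises (+ toℕ i ∷ cs)) (inject₁ i , cong +_ (sym (Fin.toℕ-inject₁ i)) , bounds) ,
    cong (_∷ cs) (cong +_ (+-comm (toℕ i) 1)) , refl)
    where
    bounds : ∀ l → InInterval (+ lowerℕ l (inject₁ i)) (widthℕ l (inject₁ i)) (Vec.lookup cs l)
    bounds l = subst (InInterval _ _) (sym (cs≡ l))
      (ℤ.+≤+ (proj₁ (chain-linked k (axis d′ π l) 0 i)) , ℤ.+≤+ (proj₂ (chain-linked k (axis d′ π l) 0 i)))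

  -- A cell strictly above the lower corner of its box steps down laterally inside the box; a lower
  -- corner steps down to the box below, which contains it by chain-linked.
  descend : ∀ c → c ∈ₛ canonical → Descends {P = canonical} norm origin c
  descend (x ∷ cs) c∈ with to (canonical-realises (x ∷ cs)) c∈
  ... | i , x≡ , bounds with Fin.any? (λ l → + lowerℕ l i ℤ.<? Vec.lookup cs l)
  ...   | yes (l , lower<) = let (t , cs-l≡ , lower≤t) = positive-above lower< in
          descend-lateral x cs i x≡ bounds l t cs-l≡ lower≤t
  ...   | no ¬lower< =
          descend-corner x cs i x≡ λ l → ℤ.≤-antisym (ℤ.≮⇒≥ (λ lt → ¬lower< (l , lt))) (proj₁ (bounds l))

  canonical-directed : Directed canonical
  canonical-directed = directed-by-descent norm origin origin-∈ descend

  coordinate-bound : ∀ c → c ∈ˢ canonicalStack → ∀ j → Σ ℕ λ a → Vec.lookup c j ≡ + a × a ≤ k + Vec.sum π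
  coordinate-bound (x ∷ cs) (i , refl , _) Fin.zero = toℕ i , refl , ≤-trans (Fin.toℕ≤pred[n] i) (m≤m+n k _)
  coordinate-bound (x ∷ cs) (i , _ , bounds) (Fin.suc l) with ≤⇒offset (proj₁ (bounds l))
  ... | t , cs-l≡ = lowerℕ l i + t , cs-l≡ ,
    ≤-trans (+-monoʳ-≤ (lowerℕ l i) (offset-cancel-≤ (+ lowerℕ l i) (subst (ℤ._≤ _) cs-l≡ (proj₂ (bounds l)))))
    (≤-trans (chain-bound k (axis d′ π l) 0 i) (≤-trans (sum-axis-≤ d′ π l) (m≤n+m (Vec.sum π) k)))

  canonical-finite : Finite canonical
  canonical-finite = cube (suc d′) (k + Vec.sum π) , λ c c∈ →
    ∈-cube (suc d′) _ c (coordinate-bound c (to (canonical-realises c) c∈))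

  canonical-nonnegative : ∀ c → c ∈ₛ canonical → ∀ j → + 0 ℤ.≤ Vec.lookup c j
  canonical-nonnegative c c∈ j with coordinate-bound c (to (canonical-realises c) c∈) j
  ... | a , c-j≡ , _ = subst (+ 0 ℤ.≤_) (sym c-j≡) (ℤ.+≤+ z≤n)

  lateral-area : sum (List.tabulate λ l → sum (List.tabulate λ i → suc (widthℕ l i))) ≡ suc k * d′ + Vec.sum π
  lateral-area = begin
    sum (List.tabulate λ l → sum (List.tabulate λ i → suc (widthℕ l i)))
      ≡⟨ cong sum (tabulate-cong {n = d′} λ l → chain-area k (axis d′ π l)) ⟩
    sum (List.tabulate λ l → suc k + Vec.sum (axis d′ π l))
      ≡⟨ sum-axis d′ (suc k) π ⟩
    d′ * suc k + Vec.sum π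
      ≡⟨ cong (_+ Vec.sum π) (*-comm d′ (suc k)) ⟩
    suc k * d′ + Vec.sum π ∎
    where open ≡-Reasoning

  canonical-DPP : DPP (suc k) (suc k * d′ + Vec.sum π) canonical
  canonical-DPP =
    (canonical-finite , (origin , origin-∈) , directed⇒connected canonical-directed) ,
    canonical-directed , stack-plateaus canonical-realises , stack-width canonical-realises ,
    area , area-card , refl , lateral-area
    where
    area : Fin (suc d′) → ℕ
    area Fin.zero = 0
    area (Fin.suc l) = sum (List.tabulate λ i → suc (widthℕ l i))
    area-card : ∀ l → l ≢ Fin.zero → Card (Projection canonical l) _≡_ (area l)
    area-card Fin.zero l≢0 = ⊥-elim (l≢0 refl)
    area-card (Fin.suc l) _ = stack-projection canonical-realises l

-- A translation between canonical shapes fixes the origin, since all their cells have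
-- nonnegative coordinates.
canonical-injective : ∀ {d′ k} (π π′ : Parameters d′ k) →
  Translate (Canonical.canonical π) (Canonical.canonical π′) → π ≡ π′
canonical-injective {d′} {k} π π′ (v , P≡Q) =
  axis-injective d′ λ l → chain-injective k 0 (λ i → ℤ.+-injective (proj₁ (proj₂ same) l i)) (proj₂ (proj₂ same) l)
  where
  module C = Canonical {d′} {k} π
  module C′ = Canonical {d′} {k} π′
  v∈ : v ∈ₛ C′.canonical
  v∈ = trans (sym (cong C′.canonical (Vec.zipWith-identityˡ ℤ.+-identityˡ v))) (trans (sym (P≡Q C.origin)) C.origin-∈)
  -v∈ : Vec.map ℤ.-_ v ∈ₛ C.canonical
  -v∈ = trans (P≡Q (Vec.map ℤ.-_ v))
    (trans (cong C′.canonical (Vec.zipWith-inverseˡ {f = ℤ._+_} ℤ.+-inverseˡ v)) C′.origin-∈)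
  v≡0 : v ≡ C.origin
  v≡0 = zero-vector v (C′.canonical-nonnegative v v∈) (C.canonical-nonnegative (Vec.map ℤ.-_ v) -v∈)
  same-shape : ∀ c → C.canonical c ≡ C′.canonical c
  same-shape c = trans (P≡Q c)
    (cong C′.canonical (trans (cong (Vec.zipWith ℤ._+_ c) v≡0) (Vec.zipWith-identityʳ ℤ.+-identityʳ c)))
  same : C.canonicalStack ≈ˢ C′.canonicalStack
  same = stack-unique C.canonical-realises
    (λ c → subst (λ b → b ≡ true ⇔ c ∈ˢ C′.canonicalStack) (sym (same-shape c)) (C′.canonical-realises c)) refl

-- Every directed plateau polyhypercube is a translate of a canonical one

module DirectedShape {d′ : ℕ} {P : Shape (suc d′)} {r₀ : ℤ} {rs : Vec ℤ d′}
  (root-∈ : (r₀ ∷ rs) ∈ₛ P) (reach : ∀ c → c ∈ₛ P → DPath P (r₀ ∷ rs) c) where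

  Level : ℕ → Set
  Level h = IsStratum P (r₀ ℤ.+ + h)

  height : ∀ c → c ∈ₛ P → Σ ℕ λ h → Vec.lookup c Fin.zero ≡ r₀ ℤ.+ + h
  height c c∈ = ≤⇒offset (DPath-mono (reach c c∈) Fin.zero)

  -- Along a directed path the height grows by at most one per step, so no level is skipped.
  DPath-levels : ∀ {c} → DPath P (r₀ ∷ rs) c → ∀ {h} → Vec.lookup c Fin.zero ≡ r₀ ℤ.+ + h →
    ∀ t → t ≤ h → Level t
  DPath-levels (here r∈) r₀≡ t t≤h with offset-injective r₀ (trans (ℤ.+-identityʳ r₀) r₀≡)
  DPath-levels (here r∈) r₀≡ zero z≤n | refl = (r₀ ∷ rs) , r∈ , sym (ℤ.+-identityʳ r₀)
  DPath-levels (next {b} j q c∈) {h} c₀≡ t t≤h with ≤⇒offset (DPath-mono q Fin.zero)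
  ... | s , b₀≡ with t ≤? s
  ...   | yes t≤s = DPath-levels q b₀≡ t t≤s
  ...   | no t≰s =
          step j b , c∈ , trans c₀≡ (cong (λ u → r₀ ℤ.+ + u) (≤-antisym (≤-trans h≤1+s (≰⇒> t≰s)) t≤h))
    where
    h≤1+s : h ≤ suc s
    h≤1+s = offset-cancel-≤ r₀
      (subst₂ ℤ._≤_ c₀≡ (trans (cong (ℤ._+ + 1) b₀≡) (offset-suc r₀ s)) (step-bounded b j Fin.zero))

  levels-downward : ∀ {s t} → s ≤ t → Level t → Level s
  levels-downward s≤t (c , c∈ , c₀≡) = DPath-levels (reach c c∈) c₀≡ _ s≤t

  Card-levels : ∀ {K} → Width P K → Card Level _≡_ K
  Card-levels = Card-comap (λ h → r₀ ℤ.+ + h) (λ h h′ _ _ → offset-injective r₀) (λ h level → level)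
    λ { z (c , c∈ , c₀≡z) → let (h , c₀≡) = height c c∈ in
          h , subst (IsStratum P) (trans (sym c₀≡z) c₀≡) (c , c∈ , c₀≡z) , trans (sym c₀≡z) c₀≡ }

  module _ {k : ℕ} {σ : Stack d′ (suc k)} (P≡σ : Realises P σ) where

    below-corner : ∀ i j → Vec.lookup (r₀ ∷ rs) j ℤ.≤ Vec.lookup (lowerCorner σ i) j
    below-corner i = DPath-mono (reach _ (from (P≡σ (lowerCorner σ i)) (lowerCorner-∈ˢ σ i)))

    root-in-first-stratum : base σ ≡ r₀ × (∀ l → lower σ l Fin.zero ≡ Vec.lookup rs l)
    root-in-first-stratum with to (P≡σ (r₀ ∷ rs)) root-∈
    ... | i , r₀≡ , bounds
      with Fin.toℕ-injective {j = Fin.zero}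
             (n≤0⇒n≡0 (offset-cancel-≤ (base σ) (subst (ℤ._≤ _) r₀≡ (below-corner Fin.zero Fin.zero))))
    ... | refl = trans (sym (ℤ.+-identityʳ (base σ))) (sym r₀≡) , λ l →
      ℤ.≤-antisym (proj₁ (bounds l))
        (subst (_ ℤ.≤_) (Vec.lookup∘tabulate (λ l → lower σ l Fin.zero) l) (below-corner Fin.zero (Fin.suc l)))

    above-root : ∀ l i → Vec.lookup rs l ℤ.≤ lower σ l i
    above-root l i = subst (_ ℤ.≤_) (Vec.lookup∘tabulate (λ l → lower σ l i) l) (below-corner i (Fin.suc l))

    -- The last step of a directed path to the lower corner of box i + 1 cannot be lateral, as it
    -- would start below that box in the same stratum; so it comes from box i, straight below.
    stack-linked : ∀ l (i : Fin k) → lower σ l (inject₁ i) ℤ.≤ lower σ l (Fin.suc i) ×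
      lower σ l (Fin.suc i) ℤ.≤ lower σ l (inject₁ i) ℤ.+ + width σ l (inject₁ i)
    stack-linked l i with DPath-last (reach _ (from (P≡σ (lowerCorner σ (Fin.suc i))) (lowerCorner-∈ˢ σ (Fin.suc i))))
    ... | inj₁ root≡corner = ⊥-elim (0≢1+n (offset-injective (base σ)
          (trans (ℤ.+-identityʳ _) (trans (proj₁ root-in-first-stratum) (Vec.∷-injectiveˡ root≡corner)))))
    ... | inj₂ (Fin.zero , (b₀ ∷ bs) , b∈ , step≡corner) with to (P≡σ (b₀ ∷ bs)) b∈
    ...   | i′ , b₀≡ , bounds with level-injective (base σ) b₀≡ b₀≡base+i
      where
      b₀≡base+i : b₀ ≡ base σ ℤ.+ + toℕ (inject₁ i)
      b₀≡base+i = ∙-cancelʳ (+ 1) b₀ _ (trans (Vec.∷-injectiveˡ step≡corner)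
        (trans (sym (offset-suc (base σ) (toℕ i))) (cong (λ t → base σ ℤ.+ + t ℤ.+ + 1) (sym (Fin.toℕ-inject₁ i)))))
    ...   | refl = subst (InInterval _ _) (trans (cong (λ v → Vec.lookup v l) (Vec.∷-injectiveʳ step≡corner))
                     (Vec.lookup∘tabulate (λ l → lower σ l (Fin.suc i)) l)) (bounds l)
    stack-linked l i | inj₂ (Fin.suc m , (b₀ ∷ bs) , b∈ , step≡corner) with to (P≡σ (b₀ ∷ bs)) b∈
    ... | i′ , b₀≡ , bounds with level-injective (base σ) b₀≡ (Vec.∷-injectiveˡ step≡corner)
    ... | refl = ⊥-elim (1+n≰n (offset-cancel-≤ (Vec.lookup bs m) (begin
      Vec.lookup bs m ℤ.+ + 1                       ≡⟨ Vec.lookup∘updateAt m bs ⟨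
      Vec.lookup (Vec.updateAt bs m (ℤ._+ + 1)) m   ≡⟨ cong (λ v → Vec.lookup v m) (Vec.∷-injectiveʳ step≡corner) ⟩
      Vec.lookup (Vec.tabulate λ l → lower σ l i′) m ≡⟨ Vec.lookup∘tabulate (λ l → lower σ l i′) m ⟩
      lower σ m i′                                  ≤⟨ proj₁ (bounds m) ⟩
      Vec.lookup bs m                               ≡⟨ ℤ.+-identityʳ _ ⟨
      Vec.lookup bs m ℤ.+ + 0                       ∎)))
      where open ℤ.≤-Reasoning

  module _ {K : ℕ} (plateaus : AllPlateaus P) (width-K : Width P K) where

    level-bound : ∀ {h} → Level h → h < K
    level-bound = proj₁ (downward-closed-card levels-downward (Card-levels width-K) _)

    level-exists : (i : Fin K) → Level (toℕ i)
    level-exists i = proj₂ (downward-closed-card levels-downward (Card-levels width-K) (toℕ i)) (Fin.toℕ<n i)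

    box : ∀ i → Σ (Cell (suc d′)) λ lo → Σ (Cell (suc d′)) λ hi → ∀ c → Vec.lookup c Fin.zero ≡ r₀ ℤ.+ + toℕ i →
      c ∈ₛ P ⇔ (∀ j → j ≢ Fin.zero → Vec.lookup lo j ℤ.≤ Vec.lookup c j × Vec.lookup c j ℤ.≤ Vec.lookup hi j)
    box i = plateaus _ (level-exists i)

    lo hi : Fin K → Fin d′ → ℤ
    lo i l = Vec.lookup (proj₁ (box i)) (Fin.suc l)
    hi i l = Vec.lookup (proj₁ (proj₂ (box i))) (Fin.suc l)

    in-box⇔ : ∀ i c → Vec.lookup c Fin.zero ≡ r₀ ℤ.+ + toℕ i →
      c ∈ₛ P ⇔ (∀ l → lo i l ℤ.≤ Vec.lookup c (Fin.suc l) × Vec.lookup c (Fin.suc l) ℤ.≤ hi i l)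
    in-box⇔ i c c₀≡ = mk⇔ (λ c∈ l → to (proj₂ (proj₂ (box i)) c c₀≡) c∈ (Fin.suc l) (λ ()))
      (λ bounds → from (proj₂ (proj₂ (box i)) c c₀≡) λ { Fin.zero 0≢0 → ⊥-elim (0≢0 refl) ; (Fin.suc l) _ → bounds l })

    box-nonempty : ∀ i l → lo i l ℤ.≤ hi i l
    box-nonempty i l =
      let (c , c∈ , c₀≡) = level-exists i ; (lo≤ , ≤hi) = to (in-box⇔ i c c₀≡) c∈ l in ℤ.≤-trans lo≤ ≤hi

    stratification : Stack d′ K
    stratification = stack r₀ (λ l i → lo i l) (λ l i → proj₁ (≤⇒offset (box-nonempty i l)))

    stratification-realises : Realises P stratification
    stratification-realises (x ∷ cs) = mk⇔ into onto
      where
      hi≡ : ∀ i l → hi i l ≡ lo i l ℤ.+ + width stratification l i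
      hi≡ i l = proj₂ (≤⇒offset (box-nonempty i l))
      into : (x ∷ cs) ∈ₛ P → (x ∷ cs) ∈ˢ stratification
      into c∈ = let (h , x≡) = height _ c∈ ; h<K = level-bound ((x ∷ cs) , c∈ , x≡)
                    x≡′ = trans x≡ (cong (λ t → r₀ ℤ.+ + t) (sym (Fin.toℕ-fromℕ< h<K))) in
        fromℕ< h<K , x≡′ , λ l →
          let (lo≤ , ≤hi) = to (in-box⇔ (fromℕ< h<K) (x ∷ cs) x≡′) c∈ l in lo≤ , subst (_ ℤ.≤_) (hi≡ _ l) ≤hi
      onto : (x ∷ cs) ∈ˢ stratification → (x ∷ cs) ∈ₛ P
      onto (i , x≡ , bounds) =
        from (in-box⇔ i (x ∷ cs) x≡) λ l → proj₁ (bounds l) , subst (_ ℤ.≤_) (sym (hi≡ i l)) (proj₂ (bounds l))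

canonical-surjective : ∀ {d′ k n} {P : Shape (suc d′)} → DPP (suc k) n P →
  Σ (Parameters d′ k) λ π → suc k * d′ + Vec.sum π ≡ n × Translate P (Canonical.canonical π)
canonical-surjective {d′} {k} {n} {P} (_ , ((r₀ ∷ rs) , root-∈ , reach) , plateaus , width-K , (A , A-card , A₀ , ΣA≡n)) =
  π , area-≡ , stack-translate (Vec.map ℤ.-_ (r₀ ∷ rs)) P≡σ (Realises-resp-≈ˢ canonical≈shifted C.canonical-realises)
  where
  open DirectedShape root-∈ reach
  σ : Stack d′ (suc k)
  σ = stratification plateaus width-K
  P≡σ : Realises P σ
  P≡σ = stratification-realises plateaus width-K

  rise : Fin (suc k) → Fin d′ → ℕ
  rise i l = proj₁ (≤⇒offset (above-root P≡σ l i))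
  lower≡ : ∀ l i → lower σ l i ≡ Vec.lookup rs l ℤ.+ + rise i l
  lower≡ l i = proj₂ (≤⇒offset (above-root P≡σ l i))
  rise-zero : ∀ l → rise Fin.zero l ≡ 0
  rise-zero l = offset-injective (Vec.lookup rs l)
    (trans (sym (lower≡ l Fin.zero)) (trans (proj₂ (root-in-first-stratum P≡σ) l) (sym (ℤ.+-identityʳ _))))
  rise-linked : ∀ l → Linked (λ i → rise i l) (λ i → width σ l i)
  rise-linked l i = let (lower≤ , ≤upper) = stack-linked P≡σ l i in
    offset-cancel-≤ (Vec.lookup rs l) (subst₂ ℤ._≤_ (lower≡ l _) (lower≡ l _) lower≤) ,
    offset-cancel-≤ (Vec.lookup rs l) (subst₂ ℤ._≤_ (lower≡ l _)
      (trans (cong (ℤ._+ + width σ l (inject₁ i)) (lower≡ l _)) (ℤ.+-assoc (Vec.lookup rs l) _ _)) ≤upper)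

  chains : ∀ l → Σ (Vec ℕ (chainLength k)) λ v →
    (∀ i → chainLower k v 0 i ≡ rise i l) × (∀ i → chainWidth k v i ≡ width σ l i)
  chains l = chain-surjective k (λ i → rise i l) (λ i → width σ l i) 0 (rise-zero l) (rise-linked l)
  parameters : Σ (Parameters d′ k) λ π → ∀ l → axis d′ π l ≡ proj₁ (chains l)
  parameters = axis-surjective d′ (λ l → proj₁ (chains l))
  π : Parameters d′ k
  π = proj₁ parameters
  module C = Canonical {d′} {k} π
  lowerℕ≡ : ∀ l i → C.lowerℕ l i ≡ rise i l
  lowerℕ≡ l i = trans (cong (λ v → chainLower k v 0 i) (proj₂ parameters l)) (proj₁ (proj₂ (chains l)) i)
  widthℕ≡ : ∀ l i → C.widthℕ l i ≡ width σ l i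
  widthℕ≡ l i = trans (cong (λ v → chainWidth k v i) (proj₂ parameters l)) (proj₂ (proj₂ (chains l)) i)

  canonical≈shifted : C.canonicalStack ≈ˢ shift (Vec.map ℤ.-_ (r₀ ∷ rs)) σ
  canonical≈shifted =
    sym (trans (cong (ℤ._+ ℤ.- r₀) (proj₁ (root-in-first-stratum P≡σ))) (ℤ.+-inverseʳ r₀)) ,
    (λ l i → begin
      + C.lowerℕ l i                                          ≡⟨ cong +_ (lowerℕ≡ l i) ⟩
      + rise i l                                              ≡⟨ cancel (Vec.lookup rs l) (+ rise i l) ⟩
      Vec.lookup rs l ℤ.+ + rise i l ℤ.+ ℤ.- Vec.lookup rs l
        ≡⟨ cong₂ ℤ._+_ (lower≡ l i) (Vec.lookup-map l ℤ.-_ rs) ⟨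
      lower σ l i ℤ.+ Vec.lookup (Vec.map ℤ.-_ rs) l          ∎) ,
    widthℕ≡
    where
    open ≡-Reasoning
    cancel : ∀ a b → b ≡ a ℤ.+ b ℤ.+ ℤ.- a
    cancel = ℤ-solve-∀

  area-≡ : suc k * d′ + Vec.sum π ≡ n
  area-≡ = begin
    suc k * d′ + Vec.sum π                                          ≡⟨ C.lateral-area ⟨
    sum (List.tabulate λ l → sum (List.tabulate λ i → suc (C.widthℕ l i)))
      ≡⟨ cong sum (tabulate-cong {n = d′} λ l → trans (cong sum (tabulate-cong {n = suc k} λ i → cong suc (widthℕ≡ l i)))
           (Card-unique (stack-projection P≡σ l) (A-card (Fin.suc l) λ ()))) ⟩
    sum (List.tabulate (A ∘ Fin.suc))                               ≡⟨ cong (_+ sum (List.tabulate (A ∘ Fin.suc))) A₀ ⟨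
    sum (List.tabulate A)                                           ≡⟨ ΣA≡n ⟩
    n                                                               ∎
    where open ≡-Reasoning

Card-DPP : ∀ d′ k n →
  Card (DPP {suc d′} (suc k) n) Translate ((mono (suc k * d′) *ˢ (invOneMinusT ^ˢ (d′ * chainLength k))) n)
Card-DPP d′ k n = Card-map {_~_ = Translate} (Canonical.canonical {d′} {k})
  (λ π π′ _ _ → canonical-injective π π′)
  (λ π area≡n → subst (λ m → DPP (suc k) m (Canonical.canonical π)) area≡n (Canonical.canonical-DPP π))
  (λ P dpp → canonical-surjective dpp)
  (Card-Vec-shifted-sum (suc k * d′) (d′ * chainLength k) n)

chainLength-exponent : ∀ d′ k → 2 * suc k * d′ ∸ d′ ≡ d′ * chainLength k
chainLength-exponent d′ k = begin
  2 * suc k * d′ ∸ d′                ≡⟨ cong (_∸ d′) (expand d′ k) ⟩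
  d′ + d′ * suc (k + k) ∸ d′         ≡⟨ m+n∸m≡n d′ _ ⟩
  d′ * suc (k + k)                   ≡⟨ cong (d′ *_) (length≡ k) ⟨
  d′ * chainLength k                 ∎
  where
  open ≡-Reasoning
  expand : ∀ d′ k → 2 * suc k * d′ ≡ d′ + d′ * suc (k + k)
  expand = ℕ-solve-∀
  length≡ : ∀ k → chainLength k ≡ suc (k + k)
  length≡ zero = refl
  length≡ (suc k) = cong (suc ∘ suc) (trans (length≡ k) (sym (+-suc k k)))

proposition1 : (d k : ℕ) → .{{_ : NonZero d}} → 3 ≤ d → 1 ≤ k →
    Σ (ℕ → ℕ) λ p →
      (∀ n → 1 ≤ n → Card (DPP {d} k n) Translate (p n)) ×
      (∀ n → seriesFrom1 p n ≡ (mono (k * (d ∸ 1)) *ˢ (invOneMinusT ^ˢ (2 * k * (d ∸ 1) ∸ (d ∸ 1)))) n)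
proposition1 1 _ (s≤s ()) _
proposition1 _ zero _ ()
proposition1 (suc d′@(suc _)) (suc k) _ _ = coefficient , (λ n _ → Card-coefficient n) , λ { zero → refl ; (suc _) → refl }
  where
  E : ℕ
  E = 2 * suc k * d′ ∸ d′
  coefficient : ℕ → ℕ
  coefficient = mono (suc k * d′) *ˢ (invOneMinusT ^ˢ E)
  Card-coefficient : ∀ n → Card (DPP (suc k) n) Translate (coefficient n)
  Card-coefficient n =
    subst (λ e → Card (DPP (suc k) n) Translate ((mono (suc k * d′) *ˢ (invOneMinusT ^ˢ e)) n))
      (sym (chainLength-exponent d′ k)) (Card-DPP d′ k n)
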